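{- Let $G$ be a connected graph of order $n\geq 5$. If $\gamma_{t[1,2]}(G)<+\infty$, then $\gamma_{t[1,2]}(G)\leq \frac{4n}{5}$, with equality if and only if $G=H\circ 2P_2$ for some connected graph $H$ of order at least two.
   Context: All graphs are finite, simple and undirected; $N(v)$ denotes the neighborhood of $v$. A set $S\subseteq V(G)$ is a total $[1,2]$-set of $G$ if $1\leq |N(v)\cap S|\leq 2$ for every vertex $v\in V(G)$. $\gamma_{t[1,2]}(G)$ is the minimum cardinality of a total $[1,2]$-set of $G$, with $\gamma_{t[1,2]}(G)=+\infty$ if no such set exists. For a graph $H$ with vertex set $\{u_1,\dots,u_k\}$, the double corona $H\circ 2P_2$ is the graph with vertex set $V(H)\cup\{x_i,x_i',y_i,y_i' : 1\leq i\leq k\}$ (all new vertices distinct) and edge set $E(H)\cup\{u_ix_i,\,x_ix_i',\,u_iy_i,\,y_iy_i' : 1\leq i\leq k\}$. -}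

module Defs where

open import Data.Nat using (ℕ; _≤_)
open import Data.Bool using (Bool; true; false; T; _∧_)
open import Data.Fin using (Fin; _≟_)
open import Data.Fin.Subset using (Subset; ∣_∣; _∩_)
open import Data.Vec using (tabulate)
open import Data.Product using (Σ; _×_; ∃-syntax)
open import Relation.Binary.PropositionalEquality using (_≡_)
open import Relation.Nullary.Decidable using (⌊_⌋)
open import Function.Bundles using (_↔_; Inverse)

record Graph (n : ℕ) : Set where
  field
    adj    : Fin n → Fin n → Bool
    sym    : ∀ u v → adj u v ≡ adj v u
    irrefl : ∀ v → adj v v ≡ false
open Graph public

data Reach {n : ℕ} (G : Graph n) : Fin n → Fin n → Set where
  here : ∀ {v} → Reach G v v
  step : ∀ {u w v} → T (adj G u w) → Reach G w v → Reach G u v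

Connected : ∀ {n} → Graph n → Set
Connected G = ∀ u v → Reach G u v

N : ∀ {n} → Graph n → Fin n → Subset n
N G v = tabulate (adj G v)

IsTotal12Set : ∀ {n} → Graph n → Subset n → Set
IsTotal12Set G S = ∀ v → 1 ≤ ∣ N G v ∩ S ∣ × ∣ N G v ∩ S ∣ ≤ 2

-- γ_{t[1,2]}(G) < +∞ : some total [1,2]-set exists.
HasTotal12Set : ∀ {n} → Graph n → Set
HasTotal12Set G = ∃[ S ] IsTotal12Set G S

IsGammaT12 : ∀ {n} → Graph n → ℕ → Set
IsGammaT12 G k =
  (∃[ S ] (IsTotal12Set G S × ∣ S ∣ ≡ k)) ×
  (∀ S → IsTotal12Set G S → k ≤ ∣ S ∣)

-- Vertex set of the double corona H ∘ 2P₂ for H on Fin k.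
data CV (k : ℕ) : Set where
  base : Fin k → CV k
  x    : Fin k → CV k
  x′   : Fin k → CV k
  y    : Fin k → CV k
  y′   : Fin k → CV k

coronaAdj : ∀ {k} → Graph k → CV k → CV k → Bool
coronaAdj H (base i) (base j) = adj H i j
coronaAdj H (base i) (x j)    = ⌊ i ≟ j ⌋
coronaAdj H (x i)    (base j) = ⌊ i ≟ j ⌋
coronaAdj H (x i)    (x′ j)   = ⌊ i ≟ j ⌋
coronaAdj H (x′ i)   (x j)    = ⌊ i ≟ j ⌋
coronaAdj H (base i) (y j)    = ⌊ i ≟ j ⌋
coronaAdj H (y i)    (base j) = ⌊ i ≟ j ⌋
coronaAdj H (y i)    (y′ j)   = ⌊ i ≟ j ⌋
coronaAdj H (y′ i)   (y j)    = ⌊ i ≟ j ⌋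
coronaAdj H _        _        = false

IsoDoubleCorona : ∀ {n k} → Graph n → Graph k → Set
IsoDoubleCorona {n} {k} G H =
  Σ (Fin n ↔ CV k) λ φ →
    ∀ u v → adj G u v ≡ coronaAdj H (Inverse.to φ u) (Inverse.to φ v)

IsDoubleCoronaOfConnected : ∀ {n} → Graph n → Set
IsDoubleCoronaOfConnected G =
  ∃[ k ] Σ (Graph k) λ H → 2 ≤ k × Connected H × IsoDoubleCorona G H

-- Let S be a minimum total [1,2]-set. By minimality every u ∈ S has a private neighbour z,
-- i.e. N(z) ∩ S = {u}. Call v ∈ S sealed if N(v) ⊆ S and exposed otherwise. A sealed v has a
-- private neighbour u inside S; u is exposed (else uv would be a component of G) and determines
-- v. Every exposed vertex sends an edge out of S, and every vertex outside S receives at most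
-- two, so |S| = |sealed| + |exposed| ≤ 2|exposed| ≤ 2 e(S, V∖S) ≤ 4 |V∖S|, i.e. 5|S| ≤ 4n.
-- In the equality case all these inequalities are tight: G[S] is a perfect matching, every
-- vertex outside S has exactly two neighbours in S, each with exactly one neighbour outside S
-- and matched to a vertex without one. This is H ∘ 2P₂ for H = G − S, which inherits
-- connectivity from G and has at least two vertices (for one, the three non-leaves would be
-- a smaller total [1,2]-set). Conversely, in H ∘ 2P₂ every total [1,2]-set contains every
-- x_i, x_i′, y_i, y_i′, so it has at least 4k = 4n/5 vertices.

module Submission where

open import Defs hiding (sym)
open import Data.Nat using (ℕ; zero; suc; _+_; _*_; _≤_; _<_; z≤n; s≤s; _≤?_; _<?_; _≡ᵇ_)
open import Data.Nat.Properties hiding (_≟_)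
open import Algebra.Properties.Semiring.Sum +-*-semiring using (sum; sum-cong-≗; ∑-comm; ∑-distrib-+; *-distribˡ-sum)
open import Data.Bool using (Bool; true; false; _∧_; not)
open import Data.Bool.Properties using (T-≡; ∧-zeroʳ; ¬-not)
open import Function.Bundles using (Equivalence; _↔_; _⇔_; Inverse; mk↔ₛ′; mk⇔)
open import Function.Properties.Inverse using (↔-trans; ↔-sym)
open import Data.Fin using (Fin; zero; suc; _≟_; remQuot; combine)
open import Data.Fin.Subset using (Subset; ∣_∣; _∩_)
open import Data.Fin.Subset.Properties using (anySubset?)
open import Data.Fin.Properties using (all?; ¬∀⟶∃¬; *↔×; combine-remQuot; injective⇒≤)
import Data.Fin.Properties as Fin
open import Data.Fin.Permutation using (↔⇒≡)
open import Data.Vec using ([]; _∷_; lookup; tabulate)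
open import Data.Vec.Properties using (lookup∘tabulate; lookup-zipWith)
open import Data.List using (List; []; _∷_; length)
open import Data.List.Membership.Propositional using (_∈_)
open import Data.List.Relation.Unary.Any using (here; there)
import Data.List.Relation.Unary.All as All
open import Data.List.Relation.Unary.Unique.Propositional using (Unique; []; _∷_)
open import Data.Product using (_×_; _,_; proj₁; proj₂; ∃-syntax)
open import Data.Sum using (_⊎_; inj₁; inj₂)
open import Data.Empty using (⊥; ⊥-elim)
open import Function using (_∘_; case_of_)
open import Relation.Nullary using (¬_; Dec; yes; no; does; contradiction)
open import Relation.Nullary.Decidable using (⌊_⌋; _×-dec_)
open import Relation.Binary.PropositionalEquality

∧-elimˡ : ∀ {a b} → a ∧ b ≡ true → a ≡ true
∧-elimˡ {true} _ = refl

∧-elimʳ : ∀ {a b} → a ∧ b ≡ true → b ≡ true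
∧-elimʳ {true} b = b

∧-intro : ∀ {a b} → a ≡ true → b ≡ true → a ∧ b ≡ true
∧-intro refl refl = refl

not≡true⇒≡false : ∀ {b} → not b ≡ true → b ≡ false
not≡true⇒≡false {false} _ = refl

⌊≟⌋≡true⇒≡ : ∀ {k} {i j : Fin k} → ⌊ i ≟ j ⌋ ≡ true → i ≡ j
⌊≟⌋≡true⇒≡ {i = i} {j} e with i ≟ j
... | yes i≡j = i≡j

⌊≟⌋-refl : ∀ {k} (i : Fin k) → ⌊ i ≟ i ⌋ ≡ true
⌊≟⌋-refl i with i ≟ i
... | yes _   = refl
... | no i≢i = ⊥-elim (i≢i refl)

≡⌊≟⌋ : ∀ {k} {b : Bool} {i j : Fin k} →
       (i ≡ j → b ≡ true) → (b ≡ true → i ≡ j) → b ≡ ⌊ i ≟ j ⌋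
≡⌊≟⌋ {i = i} {j} if only-if with i ≟ j
... | yes i≡j = if i≡j
... | no  i≢j = ¬-not (i≢j ∘ only-if)

indicator : Bool → ℕ
indicator true  = 1
indicator false = 0

count : ∀ {n} → (Fin n → Bool) → ℕ
count p = sum (indicator ∘ p)

_⊆ᵇ_ : ∀ {n} → (Fin n → Bool) → (Fin n → Bool) → Set
p ⊆ᵇ q = ∀ i → p i ≡ true → q i ≡ true

-- does rather than ⌊_⌋: only the former reduces on suc i ≟ suc a, which count-singleton needs.
_without_ : ∀ {n} → (Fin n → Bool) → Fin n → Fin n → Bool
(p without a) i = p i ∧ not (does (i ≟ a))

sum-mono-≤ : ∀ {n} {f g : Fin n → ℕ} → (∀ i → f i ≤ g i) → sum f ≤ sum g
sum-mono-≤ {zero}  f≤g = z≤n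
sum-mono-≤ {suc n} f≤g = +-mono-≤ (f≤g zero) (sum-mono-≤ (f≤g ∘ suc))

sum-mono-≤-tight : ∀ {n} {f g : Fin n → ℕ} → (∀ i → f i ≤ g i) → sum g ≤ sum f → ∀ i → f i ≡ g i
sum-mono-≤-tight {suc n} {f} {g} f≤g g≤f zero = ≤-antisym (f≤g zero)
  (+-cancelʳ-≤ (sum (g ∘ suc)) _ _ (≤-trans g≤f (+-monoʳ-≤ (f zero) (sum-mono-≤ (f≤g ∘ suc)))))
sum-mono-≤-tight {suc n} {f} {g} f≤g g≤f (suc i) = sum-mono-≤-tight (f≤g ∘ suc)
  (+-cancelˡ-≤ (g zero) _ _ (≤-trans g≤f (+-monoˡ-≤ (sum (f ∘ suc)) (f≤g zero)))) i

indicator-mono : ∀ {a b} → (a ≡ true → b ≡ true) → indicator a ≤ indicator b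
indicator-mono {false} _   = z≤n
indicator-mono {true}  a⇒b rewrite a⇒b refl = ≤-refl

count-mono : ∀ {n} {p q : Fin n → Bool} → p ⊆ᵇ q → count p ≤ count q
count-mono p⊆q = sum-mono-≤ (λ i → indicator-mono (p⊆q i))

count-mono-tight : ∀ {n} {p q : Fin n → Bool} → p ⊆ᵇ q → count q ≤ count p → q ⊆ᵇ p
count-mono-tight {p = p} {q} p⊆q q≤p i qi with p i in pi
... | true  = refl
... | false = contradiction (trans (cong indicator (sym pi)) (trans same (cong indicator qi))) λ ()
  where
  same = sum-mono-≤-tight (λ j → indicator-mono (p⊆q j)) q≤p i

count-true : ∀ n → count {n} (λ _ → true) ≡ n
count-true zero    = refl
count-true (suc n) = cong suc (count-true n)

count-false : ∀ n → count {n} (λ _ → false) ≡ 0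
count-false zero    = refl
count-false (suc n) = count-false n

count-singleton : ∀ {n} (a : Fin n) → count (λ i → does (i ≟ a)) ≡ 1
count-singleton {suc n} zero    = cong suc (count-false n)
count-singleton {suc n} (suc a) = count-singleton a

count-complement : ∀ {n} (p : Fin n → Bool) → count p + count (not ∘ p) ≡ n
count-complement {n} p = begin
  count p + count (not ∘ p)                          ≡⟨ ∑-distrib-+ (indicator ∘ p) (indicator ∘ not ∘ p) ⟨
  sum (λ i → indicator (p i) + indicator (not (p i))) ≡⟨ sum-cong-≗ (λ i → one (p i)) ⟩
  count {n} (λ _ → true)                              ≡⟨ count-true n ⟩
  n                                                   ∎
  where
  open ≡-Reasoning
  one : ∀ b → indicator b + indicator (not b) ≡ 1
  one true  = refl
  one false = refl

count-without : ∀ {n} (p : Fin n → Bool) {a} → p a ≡ true → count p ≡ suc (count (p without a))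
count-without p {a} pa = begin
  count p                                    ≡⟨ sum-cong-≗ split ⟩
  sum (λ i → indicator (p′ i) + indicator (a? i))  ≡⟨ ∑-distrib-+ (indicator ∘ p′) (indicator ∘ a?) ⟩
  count p′ + count a?                        ≡⟨ cong (count p′ +_) (count-singleton a) ⟩
  count p′ + 1                               ≡⟨ +-comm _ 1 ⟩
  suc (count p′)                             ∎
  where
  open ≡-Reasoning
  p′ = p without a
  a? : _ → Bool
  a? i = does (i ≟ a)
  split : ∀ i → indicator (p i) ≡ indicator ((p without a) i) + indicator (does (i ≟ a))
  split i with i ≟ a
  ... | yes refl rewrite pa = refl
  ... | no _ with p i
  ...   | true  = refl
  ...   | false = refl

without-≢ : ∀ {n} {p : Fin n → Bool} {a i} → p i ≡ true → ¬ i ≡ a → (p without a) i ≡ true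
without-≢ {a = a} {i} pi i≢a with i ≟ a
... | yes i≡a = ⊥-elim (i≢a i≡a)
... | no  _   rewrite pi = refl

without-⊆ : ∀ {n} {p : Fin n → Bool} {a} → (p without a) ⊆ᵇ p
without-⊆ {p = p} i e with p i
... | true = refl

without-≡ : ∀ {n} {p : Fin n → Bool} {a} → ¬ (p without a) a ≡ true
without-≡ {p = p} {a} with a ≟ a
... | yes _   = λ e → contradiction (trans (sym (∧-zeroʳ (p a))) e) λ ()
... | no  a≢a = ⊥-elim (a≢a refl)

count-pos⇒member : ∀ {n} (p : Fin n → Bool) → 1 ≤ count p → ∃[ i ] p i ≡ true
count-pos⇒member {suc n} p pos with p zero in p0
... | true  = zero , p0
... | false = let i , pi = count-pos⇒member (p ∘ suc) pos in suc i , pi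

count≤length : ∀ {n} (p : Fin n → Bool) (as : List (Fin n)) →
               (∀ i → p i ≡ true → i ∈ as) → count p ≤ length as
count≤length p [] covers with count p in eq
... | zero  = z≤n
... | suc _ with () ← covers _ (proj₂ (count-pos⇒member p (subst (1 ≤_) (sym eq) (s≤s z≤n))))
count≤length p (a ∷ as) covers with p a in pa
... | false = ≤-trans (count≤length p as covers′) (n≤1+n _)
  where
  covers′ : ∀ i → p i ≡ true → i ∈ as
  covers′ i pi with covers i pi
  ... | here refl with () ← trans (sym pi) pa
  ... | there i∈as = i∈as
... | true = subst (_≤ suc (length as)) (sym (count-without p pa)) (s≤s (count≤length (p without a) as covers′))
  where
  covers′ : ∀ i → (p without a) i ≡ true → i ∈ as
  covers′ i pi with covers i (without-⊆ {p = p} i pi)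
  ... | here refl = ⊥-elim (without-≡ {p = p} pi)
  ... | there i∈as = i∈as

length≤count : ∀ {n} (p : Fin n → Bool) {as : List (Fin n)} →
               Unique as → (∀ {i} → i ∈ as → p i ≡ true) → length as ≤ count p
length≤count p {[]}     []             _       = z≤n
length≤count p {a ∷ as} (a∉as ∷ uniq) members =
  subst (suc (length as) ≤_) (sym (count-without p (members (here refl))))
        (s≤s (length≤count (p without a) uniq members′))
  where
  members′ : ∀ {i} → i ∈ as → (p without a) i ≡ true
  members′ i∈as = without-≢ {p = p} (members (there i∈as)) (λ i≡a → All.lookup a∉as i∈as (sym i≡a))

member⇒count-pos : ∀ {n} (p : Fin n → Bool) {a} → p a ≡ true → 1 ≤ count p
member⇒count-pos p pa = length≤count p (All.[] ∷ []) λ { (here refl) → pa }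

count≤1⇒unique : ∀ {n} (p : Fin n → Bool) → count p ≤ 1 → ∀ {a b} → p a ≡ true → p b ≡ true → a ≡ b
count≤1⇒unique p ≤1 {a} {b} pa pb with a ≟ b
... | yes a≡b = a≡b
... | no  a≢b = ⊥-elim (<⇒≱ (s≤s (s≤s z≤n)) (≤-trans two≤count ≤1))
  where
  two≤count : 2 ≤ count p
  two≤count = length≤count p ((a≢b All.∷ All.[]) ∷ All.[] ∷ []) λ { (here refl) → pa ; (there (here refl)) → pb }

unique⇒count≤1 : ∀ {n} (p : Fin n → Bool) → (∀ {a b} → p a ≡ true → p b ≡ true → a ≡ b) → count p ≤ 1
unique⇒count≤1 p unique with count p in eq
... | zero  = z≤n
... | suc _ =
  let a , pa = count-pos⇒member p (subst (1 ≤_) (sym eq) (s≤s z≤n))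
  in subst (_≤ 1) eq (count≤length p (a ∷ []) (λ i pi → here (unique pi pa)))

record TwoElements {n} (p : Fin n → Bool) : Set where
  field
    fst snd  : Fin n
    fst≢snd  : ¬ fst ≡ snd
    fst∈     : p fst ≡ true
    snd∈     : p snd ≡ true
    only     : ∀ i → p i ≡ true → i ≡ fst ⊎ i ≡ snd

count≡2⇒two-elements : ∀ {n} (p : Fin n → Bool) → count p ≡ 2 → TwoElements p
count≡2⇒two-elements p two = record
  { fst = a ; snd = b ; fst≢snd = a≢b ; fst∈ = pa ; snd∈ = without-⊆ {p = p} b p′b ; only = cover }
  where
  a∈p = count-pos⇒member p (subst (1 ≤_) (sym two) (s≤s z≤n))
  a = proj₁ a∈p
  pa = proj₂ a∈p
  p′ = p without a
  count-p′ : count p′ ≡ 1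
  count-p′ = suc-injective (trans (sym (count-without p pa)) two)
  b∈p′ = count-pos⇒member p′ (≤-reflexive (sym count-p′))
  b = proj₁ b∈p′
  p′b = proj₂ b∈p′
  a≢b : ¬ a ≡ b
  a≢b a≡b = without-≡ {p = p} (subst (λ i → p′ i ≡ true) (sym a≡b) p′b)
  cover : ∀ i → p i ≡ true → i ≡ a ⊎ i ≡ b
  cover i pi with i ≟ a
  ... | yes i≡a = inj₁ i≡a
  ... | no  i≢a = inj₂ (count≤1⇒unique p′ (≤-reflexive count-p′) (without-≢ {p = p} pi i≢a) p′b)

module Enumeration where

  enumFrom : ∀ {n} (b : Bool) (p : Fin n → Bool) → Fin (indicator b + count p) → Fin (suc n)
  enum : ∀ {n} (p : Fin n → Bool) → Fin (count p) → Fin n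
  enumFrom true  p zero    = zero
  enumFrom true  p (suc j) = suc (enum p j)
  enumFrom false p j       = suc (enum p j)
  enum {suc n} p = enumFrom (p zero) (p ∘ suc)

  enumFrom-member : ∀ {n} (p : Fin (suc n) → Bool) {b} → p zero ≡ b → (j : Fin (indicator b + count (p ∘ suc))) →
    p (enumFrom b (p ∘ suc) j) ≡ true
  enum-member : ∀ {n} (p : Fin n → Bool) (j : Fin (count p)) → p (enum p j) ≡ true
  enumFrom-member p {true}  p0 zero    = p0
  enumFrom-member p {true}  p0 (suc j) = enum-member (p ∘ suc) j
  enumFrom-member p {false} p0 j       = enum-member (p ∘ suc) j
  enum-member {suc n} p = enumFrom-member p refl

  indexFrom : ∀ {n} (b : Bool) (p : Fin n → Bool) (i : Fin (suc n)) →
    (i ≡ zero → b ≡ true) → (∀ i′ → i ≡ suc i′ → p i′ ≡ true) → Fin (indicator b + count p)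
  index : ∀ {n} (p : Fin n → Bool) (i : Fin n) → p i ≡ true → Fin (count p)
  indexFrom true  p zero    _  _  = zero
  indexFrom true  p (suc i) _  ps = suc (index p i (ps _ refl))
  indexFrom false p zero    p0 _  with () ← p0 refl
  indexFrom false p (suc i) _  ps = index p i (ps _ refl)
  index {suc n} p i pi = indexFrom (p zero) (p ∘ suc) i (λ { refl → pi }) (λ { _ refl → pi })

  enumFrom-indexFrom : ∀ {n} b (p : Fin n → Bool) i p0 ps → enumFrom b p (indexFrom b p i p0 ps) ≡ i
  enum-index : ∀ {n} (p : Fin n → Bool) i (pi : p i ≡ true) → enum p (index p i pi) ≡ i
  enumFrom-indexFrom true  p zero    _  _  = refl
  enumFrom-indexFrom true  p (suc i) _  ps = cong suc (enum-index p i (ps _ refl))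
  enumFrom-indexFrom false p zero    p0 _  with () ← p0 refl
  enumFrom-indexFrom false p (suc i) _  ps = cong suc (enum-index p i (ps _ refl))
  enum-index {suc n} p i pi = enumFrom-indexFrom (p zero) (p ∘ suc) i _ _

  indexFrom-enumFrom : ∀ {n} b (p : Fin n → Bool) j p0 ps → indexFrom b p (enumFrom b p j) p0 ps ≡ j
  index-enum : ∀ {n} (p : Fin n → Bool) j (pj : p (enum p j) ≡ true) → index p (enum p j) pj ≡ j
  indexFrom-enumFrom true  p zero    _ _  = refl
  indexFrom-enumFrom true  p (suc j) _ ps = cong suc (index-enum p j (ps _ refl))
  indexFrom-enumFrom false p j       _ ps = index-enum p j (ps _ refl)
  index-enum {suc n} p j pj = indexFrom-enumFrom (p zero) (p ∘ suc) j _ _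

  enum-injective : ∀ {n} (p : Fin n → Bool) {j k} → enum p j ≡ enum p k → j ≡ k
  enum-injective p {j} {k} eq = trans (sym (index-enum p j (enum-member p j))) (index-at (enum p j) (enum-member p j) eq)
    where
    index-at : ∀ i (pi : p i ≡ true) → i ≡ enum p k → index p i pi ≡ k
    index-at _ pi refl = index-enum p k pi

  index-injective : ∀ {n} (p : Fin n → Bool) {i i′} (pi : p i ≡ true) (pi′ : p i′ ≡ true) →
                    index p i pi ≡ index p i′ pi′ → i ≡ i′
  index-injective p {i} {i′} pi pi′ eq =
    trans (sym (enum-index p i pi)) (trans (cong (enum p) eq) (enum-index p i′ pi′))

count-cong : ∀ {n} {p q : Fin n → Bool} → (∀ i → p i ≡ q i) → count p ≡ count q
count-cong p≗q = sum-cong-≗ (cong indicator ∘ p≗q)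

∣S∣≡count : ∀ {n} (S : Subset n) → ∣ S ∣ ≡ count (lookup S)
∣S∣≡count []          = refl
∣S∣≡count (true ∷ S)  = cong suc (∣S∣≡count S)
∣S∣≡count (false ∷ S) = ∣S∣≡count S

∣tabulate∣≡count : ∀ {n} (p : Fin n → Bool) → ∣ tabulate p ∣ ≡ count p
∣tabulate∣≡count p = trans (∣S∣≡count (tabulate p)) (count-cong (lookup∘tabulate p))

nbrCount : ∀ {n} → Graph n → (Fin n → Bool) → Fin n → ℕ
nbrCount G p v = count (λ t → adj G v t ∧ p t)

IsTotal12 : ∀ {n} → Graph n → (Fin n → Bool) → Set
IsTotal12 G p = ∀ v → 1 ≤ nbrCount G p v × nbrCount G p v ≤ 2

∣N∩S∣≡nbrCount : ∀ {n} (G : Graph n) (S : Subset n) v → ∣ N G v ∩ S ∣ ≡ nbrCount G (lookup S) v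
∣N∩S∣≡nbrCount G S v = trans (∣S∣≡count (N G v ∩ S)) (count-cong λ t → lookup-∩ t)
  where
  lookup-∩ : ∀ t → lookup (N G v ∩ S) t ≡ adj G v t ∧ lookup S t
  lookup-∩ t = trans (lookup-zipWith _∧_ t (N G v) S) (cong (_∧ lookup S t) (lookup∘tabulate (adj G v) t))

IsTotal12Set⇒IsTotal12 : ∀ {n} (G : Graph n) {S} → IsTotal12Set G S → IsTotal12 G (lookup S)
IsTotal12Set⇒IsTotal12 G {S} total v rewrite sym (∣N∩S∣≡nbrCount G S v) = total v

IsTotal12⇒IsTotal12Set : ∀ {n} (G : Graph n) {p} → IsTotal12 G p → IsTotal12Set G (tabulate p)
IsTotal12⇒IsTotal12Set G {p} total v
  rewrite ∣N∩S∣≡nbrCount G (tabulate p) v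
        | count-cong {p = λ t → adj G v t ∧ lookup (tabulate p) t} (λ t → cong (adj G v t ∧_) (lookup∘tabulate p t))
  = total v

minimum-total12-set : ∀ {n} (G : Graph n) → HasTotal12Set G →
  ∃[ S ] IsTotal12Set G S × (∀ S′ → IsTotal12Set G S′ → ∣ S ∣ ≤ ∣ S′ ∣)
minimum-total12-set G (S , total) = descend ∣ S ∣ S total ≤-refl
  where
  total? : ∀ S → Dec (IsTotal12Set G S)
  total? S = all? (λ v → (1 ≤? ∣ N G v ∩ S ∣) ×-dec (∣ N G v ∩ S ∣ ≤? 2))
  descend : ∀ bound S → IsTotal12Set G S → ∣ S ∣ ≤ bound →
    ∃[ M ] IsTotal12Set G M × (∀ S′ → IsTotal12Set G S′ → ∣ M ∣ ≤ ∣ S′ ∣)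
  descend bound S total ≤bound with anySubset? (λ S′ → total? S′ ×-dec (∣ S′ ∣ <? ∣ S ∣))
  descend zero        S total ≤bound | yes (S′ , _ , <S)      = ⊥-elim (<⇒≱ <S (≤-trans ≤bound z≤n))
  descend (suc bound) S total ≤bound | yes (S′ , total′ , <S) =
    descend bound S′ total′ (≤-pred (≤-trans <S ≤bound))
  ... | no ∄smaller = S , total , λ S′ total′ → ≮⇒≥ (λ <S → ∄smaller (S′ , total′ , <S))

module GraphNotation {n} (G : Graph n) where

  infix 4 _~_
  _~_ : Fin n → Fin n → Set
  u ~ v = adj G u v ≡ true

  ~-sym : ∀ {u v} → u ~ v → v ~ u
  ~-sym {u} {v} u~v = trans (Graph.sym G v u) u~v

  reach-closed : (C : Fin n → Set) → (∀ {a b} → C a → a ~ b → C b) → ∀ {u w} → C u → Reach G u w → C w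
  reach-closed C closed Cu here         = Cu
  reach-closed C closed Cu (step e walk) = reach-closed C closed (closed Cu (T-≡ .Equivalence.to e)) walk

  no-isolated-edge : 3 ≤ n → Connected G → ∀ {u v} → (∀ t → u ~ t → t ≡ v) → (∀ t → v ~ t → t ≡ u) → ⊥
  no-isolated-edge 3≤n connected {u} {v} N[u]⊆v N[v]⊆u =
    <⇒≱ 3≤n (subst (_≤ 2) (count-true n) (count≤length _ (u ∷ v ∷ []) λ t _ → member t))
    where
    UV : Fin n → Set
    UV t = t ≡ u ⊎ t ≡ v
    UV-closed : ∀ {a b} → UV a → a ~ b → UV b
    UV-closed (inj₁ refl) a~b = inj₂ (N[u]⊆v _ a~b)
    UV-closed (inj₂ refl) a~b = inj₁ (N[v]⊆u _ a~b)
    member : ∀ t → t ∈ u ∷ v ∷ []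
    member t with reach-closed UV UV-closed (inj₁ refl) (connected u t)
    ... | inj₁ t≡u = here t≡u
    ... | inj₂ t≡v = there (here t≡v)

+-self-cancel-≤ : ∀ {a b} → a + a ≤ b + b → a ≤ b
+-self-cancel-≤ a+a≤b+b = ≮⇒≥ λ b<a → <⇒≱ (+-mono-< b<a b<a) a+a≤b+b

4*≡2*+2* : ∀ q → 4 * q ≡ 2 * q + 2 * q
4*≡2*+2* q = *-distribʳ-+ q 2 2

chain-bound : ∀ {a d e q} → a ≤ d → d ≤ e → e ≤ 2 * q → a + d ≤ 4 * q
chain-bound {a} {d} {e} {q} a≤d d≤e e≤2q = begin
  a + d          ≤⟨ +-monoˡ-≤ d a≤d ⟩
  d + d          ≤⟨ +-mono-≤ d≤e d≤e ⟩
  e + e          ≤⟨ +-mono-≤ e≤2q e≤2q ⟩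
  2 * q + 2 * q  ≡⟨ 4*≡2*+2* q ⟨
  4 * q          ∎
  where open ≤-Reasoning

chain-tight : ∀ {a b c d e q} → a ≤ b → b ≤ c → c ≤ d → d ≤ e → e ≤ 2 * q → a + d ≡ 4 * q →
  c ≤ b × e ≤ d × 2 * q ≤ e
chain-tight {a} {b} {c} {d} {e} {q} a≤b b≤c c≤d d≤e e≤2q a+d≡4q = c≤b , e≤d , 2q≤e
  where
  open ≤-Reasoning
  a≤d = ≤-trans a≤b (≤-trans b≤c c≤d)
  e+e≤a+d : e + e ≤ a + d
  e+e≤a+d = begin
    e + e          ≤⟨ +-mono-≤ e≤2q e≤2q ⟩
    2 * q + 2 * q  ≡⟨ 4*≡2*+2* q ⟨
    4 * q          ≡⟨ a+d≡4q ⟨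
    a + d          ∎
  e≤d : e ≤ d
  e≤d = +-self-cancel-≤ (≤-trans e+e≤a+d (+-monoˡ-≤ d a≤d))
  c≤b : c ≤ b
  c≤b = ≤-trans c≤d (≤-trans (+-cancelʳ-≤ d d a (≤-trans (+-mono-≤ d≤e d≤e) e+e≤a+d)) a≤b)
  2q≤e : 2 * q ≤ e
  2q≤e = +-self-cancel-≤ (begin
    2 * q + 2 * q  ≡⟨ 4*≡2*+2* q ⟨
    4 * q          ≡⟨ a+d≡4q ⟨
    a + d          ≤⟨ +-monoˡ-≤ d a≤d ⟩
    d + d          ≤⟨ +-mono-≤ d≤e d≤e ⟩
    e + e          ∎)

data Side : Set where
  left right : Side

left≢right : ¬ left ≡ right
left≢right ()

xy xy′ : ∀ {k} → Side → Fin k → CV k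
xy  left  = x
xy  right = y
xy′ left  = x′
xy′ right = y′

gadget : ∀ {k} → CV k → Fin k
gadget (base i) = i
gadget (x i)    = i
gadget (x′ i)   = i
gadget (y i)    = i
gadget (y′ i)   = i

coronaAdj⇒gadget : ∀ {k} (H : Graph k) a b → coronaAdj H a b ≡ true →
  gadget a ≡ gadget b ⊎ adj H (gadget a) (gadget b) ≡ true
coronaAdj⇒gadget H (base i) (base j) e = inj₂ e
coronaAdj⇒gadget H (base i) (x j)    e = inj₁ (⌊≟⌋≡true⇒≡ e)
coronaAdj⇒gadget H (base i) (y j)    e = inj₁ (⌊≟⌋≡true⇒≡ e)
coronaAdj⇒gadget H (x i)    (base j) e = inj₁ (⌊≟⌋≡true⇒≡ e)
coronaAdj⇒gadget H (x i)    (x′ j)   e = inj₁ (⌊≟⌋≡true⇒≡ e)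
coronaAdj⇒gadget H (x′ i)   (x j)    e = inj₁ (⌊≟⌋≡true⇒≡ e)
coronaAdj⇒gadget H (y i)    (base j) e = inj₁ (⌊≟⌋≡true⇒≡ e)
coronaAdj⇒gadget H (y i)    (y′ j)   e = inj₁ (⌊≟⌋≡true⇒≡ e)
coronaAdj⇒gadget H (y′ i)   (y j)    e = inj₁ (⌊≟⌋≡true⇒≡ e)
coronaAdj⇒gadget H (base i) (x′ j) ()
coronaAdj⇒gadget H (base i) (y′ j) ()
coronaAdj⇒gadget H (x i)    (x j)  ()
coronaAdj⇒gadget H (x i)    (y j)  ()
coronaAdj⇒gadget H (x i)    (y′ j) ()
coronaAdj⇒gadget H (x′ i)   (base j) ()
coronaAdj⇒gadget H (x′ i)   (x′ j) ()
coronaAdj⇒gadget H (x′ i)   (y j)  ()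
coronaAdj⇒gadget H (x′ i)   (y′ j) ()
coronaAdj⇒gadget H (y i)    (x j)  ()
coronaAdj⇒gadget H (y i)    (x′ j) ()
coronaAdj⇒gadget H (y i)    (y j)  ()
coronaAdj⇒gadget H (y′ i)   (base j) ()
coronaAdj⇒gadget H (y′ i)   (x j)  ()
coronaAdj⇒gadget H (y′ i)   (x′ j) ()
coronaAdj⇒gadget H (y′ i)   (y′ j) ()

xy′-coronaNbr : ∀ {k} (H : Graph k) σ i c → coronaAdj H (xy′ σ i) c ≡ true → c ≡ xy σ i
xy′-coronaNbr H left  i (x j)    e = cong x (sym (⌊≟⌋≡true⇒≡ e))
xy′-coronaNbr H right i (y j)    e = cong y (sym (⌊≟⌋≡true⇒≡ e))
xy′-coronaNbr H left  i (base j) ()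
xy′-coronaNbr H left  i (x′ j)   ()
xy′-coronaNbr H left  i (y j)    ()
xy′-coronaNbr H left  i (y′ j)   ()
xy′-coronaNbr H right i (base j) ()
xy′-coronaNbr H right i (x j)    ()
xy′-coronaNbr H right i (x′ j)   ()
xy′-coronaNbr H right i (y′ j)   ()

xy-coronaNbr : ∀ {k} (H : Graph k) σ i c → coronaAdj H (xy σ i) c ≡ true → c ≡ base i ⊎ c ≡ xy′ σ i
xy-coronaNbr H left  i (base j) e = inj₁ (cong base (sym (⌊≟⌋≡true⇒≡ e)))
xy-coronaNbr H left  i (x′ j)   e = inj₂ (cong x′ (sym (⌊≟⌋≡true⇒≡ e)))
xy-coronaNbr H right i (base j) e = inj₁ (cong base (sym (⌊≟⌋≡true⇒≡ e)))
xy-coronaNbr H right i (y′ j)   e = inj₂ (cong y′ (sym (⌊≟⌋≡true⇒≡ e)))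
xy-coronaNbr H left  i (x j)    ()
xy-coronaNbr H left  i (y j)    ()
xy-coronaNbr H left  i (y′ j)   ()
xy-coronaNbr H right i (x j)    ()
xy-coronaNbr H right i (x′ j)   ()
xy-coronaNbr H right i (y j)    ()

base-coronaAdj-xy : ∀ {k} (H : Graph k) σ i → coronaAdj H (base i) (xy σ i) ≡ true
base-coronaAdj-xy H left  i = ⌊≟⌋-refl i
base-coronaAdj-xy H right i = ⌊≟⌋-refl i

tag : ∀ {k} → CV k → Fin 5 × Fin k
tag (base i) = zero , i
tag (x i)    = suc zero , i
tag (x′ i)   = suc (suc zero) , i
tag (y i)    = suc (suc (suc zero)) , i
tag (y′ i)   = suc (suc (suc (suc zero))) , i

untag : ∀ {k} → Fin 5 × Fin k → CV k
untag (zero , i)                         = base i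
untag (suc zero , i)                     = x i
untag (suc (suc zero) , i)               = x′ i
untag (suc (suc (suc zero)) , i)         = y i
untag (suc (suc (suc (suc zero))) , i)   = y′ i

CV↔Fin5×Fin : ∀ {k} → CV k ↔ (Fin 5 × Fin k)
CV↔Fin5×Fin = mk↔ₛ′ tag untag tag∘untag untag∘tag
  where
  tag∘untag : ∀ p → tag (untag p) ≡ p
  tag∘untag (zero , i)                       = refl
  tag∘untag (suc zero , i)                   = refl
  tag∘untag (suc (suc zero) , i)             = refl
  tag∘untag (suc (suc (suc zero)) , i)       = refl
  tag∘untag (suc (suc (suc (suc zero))) , i) = refl
  untag∘tag : ∀ c → untag (tag c) ≡ c
  untag∘tag (base i) = refl
  untag∘tag (x i)    = refl
  untag∘tag (x′ i)   = refl
  untag∘tag (y i)    = refl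
  untag∘tag (y′ i)   = refl

no-isolated-vertex : ∀ {k} (H : Graph k) → 2 ≤ k → Connected H → ∀ i → ∃[ j ] adj H i j ≡ true
no-isolated-vertex H (s≤s (s≤s _)) connected i = first-step (other-≢ i) (connected i (other i))
  where
  other : Fin _ → Fin _
  other zero    = suc zero
  other (suc _) = zero
  other-≢ : ∀ i → ¬ i ≡ other i
  other-≢ zero    ()
  other-≢ (suc _) ()
  first-step : ∀ {j} → ¬ i ≡ j → Reach H i j → ∃[ j ] adj H i j ≡ true
  first-step i≢j here                = ⊥-elim (i≢j refl)
  first-step _   (step {w = w} e _) = w , T-≡ .Equivalence.to e

module DoubleCorona {n k} (G : Graph n) (H : Graph k) (iso : Fin n ↔ CV k)
                    (iso-adj : ∀ u v → adj G u v ≡ coronaAdj H (Inverse.to iso u) (Inverse.to iso v)) where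
  open GraphNotation G

  open Inverse iso using (to; strictlyInverseˡ; strictlyInverseʳ) renaming (from to ψ)

  ψ-adj : ∀ a b → adj G (ψ a) (ψ b) ≡ coronaAdj H a b
  ψ-adj a b = trans (iso-adj (ψ a) (ψ b)) (cong₂ (coronaAdj H) (strictlyInverseˡ a) (strictlyInverseˡ b))

  H-connected : Connected G → Connected H
  H-connected connected i j =
    subst₂ (Reach H) (cong gadget (strictlyInverseˡ (base i))) (cong gadget (strictlyInverseˡ (base j)))
           (project (connected (ψ (base i)) (ψ (base j))))
    where
    project : ∀ {u v} → Reach G u v → Reach H (gadget (to u)) (gadget (to v))
    project here = here
    project {u} (step {w = w} u~w walk)
      with coronaAdj⇒gadget H (to u) (to w) (trans (sym (iso-adj u w)) (T-≡ .Equivalence.to u~w))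
    ... | inj₁ same rewrite same = project walk
    ... | inj₂ H-adj = step (T-≡ .Equivalence.from H-adj) (project walk)

  ψ-injective : ∀ {a b} → ψ a ≡ ψ b → a ≡ b
  ψ-injective {a} {b} e = trans (sym (strictlyInverseˡ a)) (trans (cong to e) (strictlyInverseˡ b))

  order : n ≡ 5 * k
  order = ↔⇒≡ (↔-trans iso (↔-trans CV↔Fin5×Fin (↔-sym *↔×)))

  module _ (s : Fin n → Bool) (total : IsTotal12 G s) (no-isolated : ∀ i → ∃[ j ] adj H i j ≡ true) where

    sNbr : ∀ c → ∃[ c′ ] coronaAdj H c c′ ≡ true × s (ψ c′) ≡ true
    sNbr c =
      let t , e = count-pos⇒member (λ t → adj G (ψ c) t ∧ s t) (proj₁ (total (ψ c)))
          ψc′≡t = strictlyInverseʳ t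
      in to t , trans (sym (ψ-adj c _)) (trans (cong (adj G (ψ c)) ψc′≡t) (∧-elimˡ {adj G (ψ c) t} e))
                          , trans (cong s ψc′≡t) (∧-elimʳ {adj G (ψ c) t} e)

    xy∈S : ∀ σ i → s (ψ (xy σ i)) ≡ true
    xy∈S σ i =
      let c′ , c~c′ , c′∈S = sNbr (xy′ σ i) in subst (λ c → s (ψ c) ≡ true) (xy′-coronaNbr H σ i c′ c~c′) c′∈S

    -- A base vertex in S, together with x j and y j, would give its H-neighbour u_j three S-neighbours.
    base∉S : ∀ i → s (ψ (base i)) ≡ false
    base∉S i with s (ψ (base i)) in base∈S
    ... | false = refl
    ... | true  = ⊥-elim (<⇒≱ (s≤s (s≤s (s≤s z≤n))) (≤-trans three (proj₂ (total (ψ (base j))))))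
      where
      j = proj₁ (no-isolated i)
      distinct : Unique (ψ (base i) ∷ ψ (x j) ∷ ψ (y j) ∷ [])
      distinct = ((λ e → case ψ-injective e of λ ()) All.∷ (λ e → case ψ-injective e of λ ()) All.∷ All.[])
               ∷ ((λ e → case ψ-injective e of λ ()) All.∷ All.[]) ∷ All.[] ∷ []
      nbr∈S : ∀ c → coronaAdj H (base j) c ≡ true → s (ψ c) ≡ true → adj G (ψ (base j)) (ψ c) ∧ s (ψ c) ≡ true
      nbr∈S c e c∈S = ∧-intro (trans (ψ-adj (base j) c) e) c∈S
      three : 3 ≤ nbrCount G s (ψ (base j))
      three = length≤count _ distinct λ where
        (here refl)                 → nbr∈S (base i) (trans (Graph.sym H j i) (proj₂ (no-isolated i))) base∈S
        (there (here refl))         → nbr∈S (x j) (base-coronaAdj-xy H left j) (xy∈S left j)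
        (there (there (here refl))) → nbr∈S (y j) (base-coronaAdj-xy H right j) (xy∈S right j)

    xy′∈S : ∀ σ i → s (ψ (xy′ σ i)) ≡ true
    xy′∈S σ i with sNbr (xy σ i)
    ... | c′ , c~c′ , c′∈S with xy-coronaNbr H σ i c′ c~c′
    ...   | inj₁ refl = contradiction (trans (sym c′∈S) (base∉S i)) λ ()
    ...   | inj₂ refl = c′∈S

    nonbase∈S : ∀ a i → s (ψ (untag (suc a , i))) ≡ true
    nonbase∈S zero                   i = xy∈S left i
    nonbase∈S (suc zero)             i = xy′∈S left i
    nonbase∈S (suc (suc zero))       i = xy∈S right i
    nonbase∈S (suc (suc (suc zero))) i = xy′∈S right i

    4*k≤|S| : 4 * k ≤ count s
    4*k≤|S| = injective⇒≤ {f = select} select-injective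
      where
      open Enumeration
      select : Fin (4 * k) → Fin (count s)
      select e = let a , i = remQuot {4} k e in index s (ψ (untag (suc a , i))) (nonbase∈S a i)
      select-injective : ∀ {e e′} → select e ≡ select e′ → e ≡ e′
      select-injective {e} {e′} eq = begin
        e                             ≡⟨ combine-remQuot {4} k e ⟨
        combine (proj₁ q) (proj₂ q)   ≡⟨ cong (λ p → combine (proj₁ p) (proj₂ p)) q≡q′ ⟩
        combine (proj₁ q′) (proj₂ q′) ≡⟨ combine-remQuot {4} k e′ ⟩
        e′                            ∎
        where
        open ≡-Reasoning
        q  = remQuot {4} k e
        q′ = remQuot {4} k e′
        tagged : (suc (proj₁ q) , proj₂ q) ≡ (suc (proj₁ q′) , proj₂ q′)
        tagged = trans (sym (Inverse.strictlyInverseˡ CV↔Fin5×Fin _))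
                       (trans (cong tag (ψ-injective (index-injective s (nonbase∈S _ _) (nonbase∈S _ _) eq)))
                              (Inverse.strictlyInverseˡ CV↔Fin5×Fin _))
        q≡q′ : q ≡ q′
        q≡q′ = cong₂ _,_ (Fin.suc-injective (cong proj₁ tagged)) (cong proj₂ tagged)

module MinimumTotal12 {n} (G : Graph n) (3≤n : 3 ≤ n) (connected : Connected G)
                      (s : Fin n → Bool) (total : IsTotal12 G s)
                      (minimum : ∀ p → IsTotal12 G p → count s ≤ count p) where
  open GraphNotation G

  _∈S : Fin n → Set
  t ∈S = s t ≡ true

  _∉S : Fin n → Set
  t ∉S = s t ≡ false

  SoleSNbr : Fin n → Fin n → Set
  SoleSNbr z u = ∀ t → z ~ t → t ∈S → t ≡ u

  sNbrs : Fin n → Fin n → Bool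
  sNbrs v t = adj G v t ∧ s t

  has-sNbr : ∀ v → ∃[ t ] v ~ t × t ∈S
  has-sNbr v = let t , e = count-pos⇒member (sNbrs v) (proj₁ (total v)) in t , ∧-elimˡ e , ∧-elimʳ e

  sole⇒nbrCount≤1 : ∀ {v u} → SoleSNbr v u → nbrCount G s v ≤ 1
  sole⇒nbrCount≤1 {v} sole = unique⇒count≤1 (sNbrs v) λ ea eb →
    trans (sole _ (∧-elimˡ ea) (∧-elimʳ ea)) (sym (sole _ (∧-elimˡ eb) (∧-elimʳ eb)))

  nbrCount≤1⇒sole : ∀ {v u} → nbrCount G s v ≤ 1 → v ~ u → u ∈S → SoleSNbr v u
  nbrCount≤1⇒sole {v} ≤1 v~u u∈S t v~t t∈S =
    count≤1⇒unique (sNbrs v) ≤1 (∧-intro v~t t∈S) (∧-intro v~u u∈S)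

  private-nbr : ∀ {u} → u ∈S → ∃[ z ] z ~ u × SoleSNbr z u
  private-nbr {u} u∈S = z , z~u , sole
    where
    p′ = s without u
    ¬total′ : ¬ IsTotal12 G p′
    ¬total′ total′ = <⇒≱ (subst (count p′ <_) (sym (count-without s u∈S)) (n<1+n _)) (minimum p′ total′)
    violation = ¬∀⟶∃¬ n _ (λ v → (1 ≤? nbrCount G p′ v) ×-dec (nbrCount G p′ v ≤? 2)) ¬total′
    z = proj₁ violation
    p′-nbrs⊆ : (λ t → adj G z t ∧ p′ t) ⊆ᵇ sNbrs z
    p′-nbrs⊆ t e = ∧-intro (∧-elimˡ {adj G z t} e) (without-⊆ {p = s} t (∧-elimʳ {adj G z t} e))
    no-p′-nbr : ¬ 1 ≤ nbrCount G p′ z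
    no-p′-nbr pos = proj₂ violation (pos , ≤-trans (count-mono p′-nbrs⊆) (proj₂ (total z)))
    sole : SoleSNbr z u
    sole t z~t t∈S with t ≟ u
    ... | yes t≡u = t≡u
    ... | no  t≢u =
      ⊥-elim (no-p′-nbr (member⇒count-pos (λ t → adj G z t ∧ p′ t) (∧-intro z~t (without-≢ {p = s} t∈S t≢u))))
    z~u : z ~ u
    z~u = let t , z~t , t∈S = has-sNbr z in subst (z ~_) (sole t z~t t∈S) z~t

  outNbrs : Fin n → Fin n → Bool
  outNbrs v t = adj G v t ∧ not (s t)

  outDeg : Fin n → ℕ
  outDeg v = count (outNbrs v)

  outDeg≡0⇒nbr∈S : ∀ {v t} → outDeg v ≡ 0 → v ~ t → t ∈S
  outDeg≡0⇒nbr∈S {v} {t} none v~t with s t in st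
  ... | true  = refl
  ... | false with () ← subst (1 ≤_) none (member⇒count-pos (outNbrs v) (∧-intro v~t (cong not st)))

  sealed exposed : Fin n → Bool
  sealed  v = s v ∧ (outDeg v ≡ᵇ 0)
  exposed v = s v ∧ not (outDeg v ≡ᵇ 0)

  sealed⇒outDeg≡0 : ∀ {v} → sealed v ≡ true → outDeg v ≡ 0
  sealed⇒outDeg≡0 {v} e with s v | outDeg v
  sealed⇒outDeg≡0 refl | true | zero = refl

  count-s≡sealed+exposed : count s ≡ count sealed + count exposed
  count-s≡sealed+exposed = trans (sum-cong-≗ split) (∑-distrib-+ (indicator ∘ sealed) (indicator ∘ exposed))
    where
    split : ∀ v → indicator (s v) ≡ indicator (sealed v) + indicator (exposed v)
    split v with s v | outDeg v
    ... | false | _     = refl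
    ... | true  | zero  = refl
    ... | true  | suc _ = refl

  sPrivate : Fin n → Fin n → Bool
  sPrivate u v = s u ∧ (sNbrs u v ∧ (nbrCount G s u ≡ᵇ 1))

  record IsSPrivate (u v : Fin n) : Set where
    field
      source∈S : u ∈S
      adjacent : u ~ v
      target∈S : v ∈S
      sole     : SoleSNbr u v

  sPrivate-sound : ∀ {u v} → sPrivate u v ≡ true → IsSPrivate u v
  sPrivate-sound {u} {v} e = record
    { source∈S = ∧-elimˡ e ; adjacent = u~v ; target∈S = v∈S ; sole = nbrCount≤1⇒sole (≤-reflexive one) u~v v∈S }
    where
    one : nbrCount G s u ≡ 1
    one = ≡ᵇ⇒≡ _ 1 (T-≡ .Equivalence.from (∧-elimʳ {sNbrs u v} (∧-elimʳ {s u} e)))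
    u~v : u ~ v
    u~v = ∧-elimˡ {adj G u v} (∧-elimˡ {sNbrs u v} (∧-elimʳ {s u} e))
    v∈S : v ∈S
    v∈S = ∧-elimʳ {adj G u v} (∧-elimˡ {sNbrs u v} (∧-elimʳ {s u} e))

  sPrivate-complete : ∀ {u v} → IsSPrivate u v → sPrivate u v ≡ true
  sPrivate-complete {u} {v} p =
    ∧-intro source∈S (∧-intro (∧-intro adjacent target∈S) (T-≡ .Equivalence.to (≡⇒≡ᵇ _ 1 one)))
    where
    open IsSPrivate p
    one : nbrCount G s u ≡ 1
    one = ≤-antisym (sole⇒nbrCount≤1 sole) (proj₁ (total u))

  sealed⇒nbr∈S : ∀ {v t} → sealed v ≡ true → v ~ t → t ∈S
  sealed⇒nbr∈S sv = outDeg≡0⇒nbr∈S (sealed⇒outDeg≡0 sv)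

  sealed-has-sPrivate : ∀ {v} → sealed v ≡ true → ∃[ u ] IsSPrivate u v
  sealed-has-sPrivate {v} sv =
    let z , z~v , sole = private-nbr (∧-elimˡ {s v} sv)
    in z , record { source∈S = sealed⇒nbr∈S sv (~-sym z~v) ; adjacent = z~v
                  ; target∈S = ∧-elimˡ {s v} sv ; sole = sole }

  sPrivate-functional : ∀ {u v v′} → IsSPrivate u v → IsSPrivate u v′ → v ≡ v′
  sPrivate-functional p p′ = sym (IsSPrivate.sole p _ (IsSPrivate.adjacent p′) (IsSPrivate.target∈S p′))

  -- A sealed u with the sealed v as its only S-neighbour would make uv a component of G.
  sPrivate-of-sealed-is-exposed : ∀ {u v} → IsSPrivate u v → sealed v ≡ true → exposed u ≡ true
  sPrivate-of-sealed-is-exposed {u} {v} p sv with outDeg u in out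
  ... | suc _ rewrite IsSPrivate.source∈S p = refl
  ... | zero  = ⊥-elim (no-isolated-edge 3≤n connected N[u]⊆v N[v]⊆u)
    where
    open IsSPrivate p
    N[u]⊆v : ∀ t → u ~ t → t ≡ v
    N[u]⊆v t u~t = sole t u~t (outDeg≡0⇒nbr∈S out u~t)
    N[v]⊆u : ∀ t → v ~ t → t ≡ u
    N[v]⊆u t v~t =
      let z , z~u , z-sole = private-nbr source∈S
      in z-sole t (subst (_~ t) (sym (N[u]⊆v z (~-sym z~u))) v~t) (sealed⇒nbr∈S sv v~t)

  cutEdge : Fin n → Fin n → Bool
  cutEdge v w = s v ∧ outNbrs v w

  sealedPairs exposedPairs cut outside : ℕ
  sealedPairs  = sum λ v → count λ u → sealed v ∧ sPrivate u v
  exposedPairs = sum λ v → count λ u → exposed u ∧ sPrivate u v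
  cut          = sum λ v → count (cutEdge v)
  outside      = count (not ∘ s)

  sealed≤sealedPairs : count sealed ≤ sealedPairs
  sealed≤sealedPairs = sum-mono-≤ has-pair
    where
    has-pair : ∀ v → indicator (sealed v) ≤ count (λ u → sealed v ∧ sPrivate u v)
    has-pair v with sealed v in sv
    ... | false = z≤n
    ... | true  = let u , p = sealed-has-sPrivate sv in member⇒count-pos (λ u → sPrivate u v) (sPrivate-complete p)

  sealed-pair⇒exposed-pair : ∀ v → (λ u → sealed v ∧ sPrivate u v) ⊆ᵇ (λ u → exposed u ∧ sPrivate u v)
  sealed-pair⇒exposed-pair v u e =
    let private-uv = ∧-elimʳ {sealed v} e
    in ∧-intro (sPrivate-of-sealed-is-exposed (sPrivate-sound private-uv) (∧-elimˡ {sealed v} e)) private-uv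

  sealedPairs≤exposedPairs : sealedPairs ≤ exposedPairs
  sealedPairs≤exposedPairs = sum-mono-≤ λ v → count-mono (sealed-pair⇒exposed-pair v)

  exposedPairs≤exposed : exposedPairs ≤ count exposed
  exposedPairs≤exposed = begin
    exposedPairs                                   ≡⟨ ∑-comm (λ v u → indicator (exposed u ∧ sPrivate u v)) ⟩
    sum (λ u → count λ v → exposed u ∧ sPrivate u v) ≤⟨ sum-mono-≤ at-most-one ⟩
    count exposed                                  ∎
    where
    open ≤-Reasoning
    at-most-one : ∀ u → count (λ v → exposed u ∧ sPrivate u v) ≤ indicator (exposed u)
    at-most-one u with exposed u
    ... | false = ≤-reflexive (count-false n)
    ... | true  = unique⇒count≤1 (sPrivate u) λ pa pb → sPrivate-functional (sPrivate-sound pa) (sPrivate-sound pb)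

  exposed⇒cutEdge : ∀ v → indicator (exposed v) ≤ count (cutEdge v)
  exposed⇒cutEdge v with s v
  ... | false = z≤n
  ... | true with outDeg v
  ...   | zero  = z≤n
  ...   | suc _ = s≤s z≤n

  exposed≤cut : count exposed ≤ cut
  exposed≤cut = sum-mono-≤ exposed⇒cutEdge

  cutEdges-into : ∀ w → count (λ v → cutEdge v w) ≤ 2 * indicator (not (s w))
  cutEdges-into w with s w
  ... | true  = count≤length _ [] λ v e → contradiction (trans (sym (∧-zeroʳ (adj G v w))) (∧-elimʳ {s v} e)) λ ()
  ... | false = ≤-trans (count-mono λ v e → ∧-intro (~-sym (∧-elimˡ {adj G v w} (∧-elimʳ {s v} e))) (∧-elimˡ {s v} e))
                        (proj₂ (total w))

  cut≡cut-into : cut ≡ sum (λ w → count λ v → cutEdge v w)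
  cut≡cut-into = ∑-comm (λ v w → indicator (cutEdge v w))

  cut≤2*outside : cut ≤ 2 * outside
  cut≤2*outside = begin
    cut                                      ≡⟨ cut≡cut-into ⟩
    sum (λ w → count λ v → cutEdge v w)      ≤⟨ sum-mono-≤ cutEdges-into ⟩
    sum (λ w → 2 * indicator (not (s w)))    ≡⟨ *-distribˡ-sum 2 (indicator ∘ not ∘ s) ⟨
    2 * outside                              ∎
    where open ≤-Reasoning

  |S|≤4*outside : count s ≤ 4 * outside
  |S|≤4*outside = subst (_≤ 4 * outside) (sym count-s≡sealed+exposed)
    (chain-bound {q = outside} (≤-trans sealed≤sealedPairs (≤-trans sealedPairs≤exposedPairs exposedPairs≤exposed))
                 exposed≤cut cut≤2*outside)

  5*|S|≤4*n : 5 * count s ≤ 4 * n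
  5*|S|≤4*n = begin
    5 * count s                  ≡⟨⟩
    count s + 4 * count s        ≤⟨ +-monoˡ-≤ (4 * count s) |S|≤4*outside ⟩
    4 * outside + 4 * count s    ≡⟨ +-comm (4 * outside) (4 * count s) ⟩
    4 * count s + 4 * outside    ≡⟨ *-distribˡ-+ 4 (count s) outside ⟨
    4 * (count s + outside)      ≡⟨ cong (4 *_) (count-complement s) ⟩
    4 * n                        ∎
    where open ≤-Reasoning

  cutEdge-into⊆sNbrs : ∀ w → (λ v → cutEdge v w) ⊆ᵇ sNbrs w
  cutEdge-into⊆sNbrs w v e = ∧-intro (~-sym (∧-elimˡ {adj G v w} (∧-elimʳ {s v} e))) (∧-elimˡ {s v} e)

  module Extremal (5*|S|≡4*n : 5 * count s ≡ 4 * n) where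

    |S|≡4*outside : count s ≡ 4 * outside
    |S|≡4*outside = +-cancelˡ-≡ (4 * count s) _ _ (begin
      4 * count s + count s        ≡⟨ +-comm (4 * count s) (count s) ⟩
      5 * count s                  ≡⟨ 5*|S|≡4*n ⟩
      4 * n                        ≡⟨ cong (4 *_) (count-complement s) ⟨
      4 * (count s + outside)      ≡⟨ *-distribˡ-+ 4 (count s) outside ⟩
      4 * count s + 4 * outside    ∎)
      where open ≡-Reasoning

    private
      tight = chain-tight {q = outside}
        sealed≤sealedPairs sealedPairs≤exposedPairs exposedPairs≤exposed exposed≤cut cut≤2*outside
        (trans (sym count-s≡sealed+exposed) |S|≡4*outside)

    outside-two-sNbrs : ∀ {w} → w ∉S → nbrCount G s w ≡ 2
    outside-two-sNbrs {w} w∉S = ≤-antisym (proj₂ (total w)) (begin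
      2                                    ≡⟨ cong (λ b → 2 * indicator (not b)) w∉S ⟨
      2 * indicator (not (s w))            ≡⟨ into-tight w ⟨
      count (λ v → cutEdge v w)            ≤⟨ count-mono (cutEdge-into⊆sNbrs w) ⟩
      nbrCount G s w                       ∎)
      where
      open ≤-Reasoning
      into-tight = sum-mono-≤-tight cutEdges-into (begin
        sum (λ w → 2 * indicator (not (s w)))  ≡⟨ *-distribˡ-sum 2 (indicator ∘ not ∘ s) ⟨
        2 * outside                            ≤⟨ proj₂ (proj₂ tight) ⟩
        cut                                    ≡⟨ cut≡cut-into ⟩
        sum (λ w → count λ v → cutEdge v w)    ∎)

    outDeg≤1 : ∀ {v} → v ∈S → outDeg v ≤ 1
    outDeg≤1 {v} v∈S =
      subst (_≤ 1) (trans exposed≡cut (cong (λ b → count (λ w → b ∧ outNbrs v w)) v∈S)) (indicator≤1 _)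
      where
      exposed≡cut = sum-mono-≤-tight exposed⇒cutEdge (proj₁ (proj₂ tight)) v
      indicator≤1 : ∀ b → indicator b ≤ 1
      indicator≤1 true  = ≤-refl
      indicator≤1 false = z≤n

    sPrivate-of-exposed-is-sealed : ∀ {u v} → IsSPrivate u v → exposed u ≡ true → sealed v ≡ true
    sPrivate-of-exposed-is-sealed {u} {v} p eu = ∧-elimˡ {sealed v}
      (count-mono-tight (sealed-pair⇒exposed-pair v) (≤-reflexive (sym pairs-tight)) u (∧-intro eu (sPrivate-complete p)))
      where
      pairs-tight = sum-mono-≤-tight (λ v → count-mono (sealed-pair⇒exposed-pair v)) (proj₁ tight) v

    S-private-nbr : ∀ {u} → u ∈S → ∃[ z ] z ∈S × z ~ u × SoleSNbr z u
    S-private-nbr u∈S with private-nbr u∈S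
    ... | z , z~u , sole with s z in z∈S
    ...   | true  = z , z∈S , z~u , sole
    ...   | false = ⊥-elim (<⇒≱ (s≤s (s≤s z≤n)) (subst (_≤ 1) (outside-two-sNbrs z∈S) (sole⇒nbrCount≤1 sole)))

    opaque
      sole-sNbr : ∀ {u} → u ∈S → ∃[ m ] m ∈S × u ~ m × SoleSNbr u m
      sole-sNbr u∈S =
        let z  , z∈S  , z~u  , z-sole  = S-private-nbr u∈S
            z′ , z′∈S , z′~z , z′-sole = S-private-nbr z∈S
        in z , z∈S , ~-sym z~u , subst (λ a → SoleSNbr a z) (z-sole z′ (~-sym z′~z) z′∈S) z′-sole

    S-nbr-is-sole : ∀ {u v} → u ∈S → v ∈S → u ~ v → SoleSNbr u v
    S-nbr-is-sole u∈S v∈S u~v t u~t t∈S =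
      let m , _ , _ , m-sole = sole-sNbr u∈S in trans (m-sole t u~t t∈S) (sym (m-sole _ u~v v∈S))

    outDeg≡0⊎1 : ∀ {u} → u ∈S → outDeg u ≡ 0 ⊎ outDeg u ≡ 1
    outDeg≡0⊎1 {u} u∈S with outDeg u | outDeg≤1 u∈S
    ... | zero        | _ = inj₁ refl
    ... | suc zero    | _ = inj₂ refl
    ... | suc (suc _) | s≤s ()

    outDeg≡1⇒exposed : ∀ {u} → u ∈S → outDeg u ≡ 1 → exposed u ≡ true
    outDeg≡1⇒exposed {u} u∈S one rewrite u∈S | one = refl

    mate-of-outDeg-1 : ∀ {u v} → u ∈S → v ∈S → u ~ v → outDeg u ≡ 1 → outDeg v ≡ 0
    mate-of-outDeg-1 u∈S v∈S u~v one = sealed⇒outDeg≡0 (sPrivate-of-exposed-is-sealed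
      (record { source∈S = u∈S ; adjacent = u~v ; target∈S = v∈S ; sole = S-nbr-is-sole u∈S v∈S u~v })
      (outDeg≡1⇒exposed u∈S one))

    mate-of-outDeg-0 : ∀ {u v} → u ∈S → v ∈S → u ~ v → outDeg u ≡ 0 → outDeg v ≡ 1
    mate-of-outDeg-0 {u} {v} u∈S v∈S u~v none with outDeg≡0⊎1 v∈S
    ... | inj₂ one = one
    ... | inj₁ none′ = ⊥-elim (no-isolated-edge 3≤n connected
      (λ t u~t → S-nbr-is-sole u∈S v∈S u~v t u~t (outDeg≡0⇒nbr∈S none u~t))
      (λ t v~t → S-nbr-is-sole v∈S u∈S (~-sym u~v) t v~t (outDeg≡0⇒nbr∈S none′ v~t)))

    outside-nbr⇒outDeg-1 : ∀ {u w} → u ∈S → w ∉S → u ~ w → outDeg u ≡ 1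
    outside-nbr⇒outDeg-1 {u} {w} u∈S w∉S u~w with outDeg≡0⊎1 u∈S
    ... | inj₂ one  = one
    ... | inj₁ none with () ← trans (sym (outDeg≡0⇒nbr∈S none u~w)) w∉S

    outside-nbr-unique : ∀ {u w w′} → u ∈S → w ∉S → w′ ∉S → u ~ w → u ~ w′ → w ≡ w′
    outside-nbr-unique {u} u∈S w∉S w′∉S u~w u~w′ =
      count≤1⇒unique (outNbrs u) (outDeg≤1 u∈S) (∧-intro u~w (cong not w∉S)) (∧-intro u~w′ (cong not w′∉S))

    open Enumeration

    U : Fin outside → Fin n
    U = enum (not ∘ s)

    U∉S : ∀ i → U i ∉S
    U∉S i = not≡true⇒≡false (enum-member (not ∘ s) i)

    U-index : ∀ {w} (w∉S : w ∉S) → U (index (not ∘ s) w (cong not w∉S)) ≡ w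
    U-index {w} w∉S = enum-index (not ∘ s) w (cong not w∉S)

    U-injective : ∀ {i j} → U i ≡ U j → i ≡ j
    U-injective = enum-injective (not ∘ s)

    private opaque
      sNbrs-of-U : ∀ i → TwoElements (sNbrs (U i))
      sNbrs-of-U i = count≡2⇒two-elements (sNbrs (U i)) (outside-two-sNbrs (U∉S i))

    support : Side → Fin outside → Fin n
    support left  i = TwoElements.fst (sNbrs-of-U i)
    support right i = TwoElements.snd (sNbrs-of-U i)

    support-sNbr : ∀ σ i → sNbrs (U i) (support σ i) ≡ true
    support-sNbr left  i = TwoElements.fst∈ (sNbrs-of-U i)
    support-sNbr right i = TwoElements.snd∈ (sNbrs-of-U i)

    U~support : ∀ σ i → U i ~ support σ i
    U~support σ i = ∧-elimˡ {adj G (U i) (support σ i)} (support-sNbr σ i)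

    support∈S : ∀ σ i → support σ i ∈S
    support∈S σ i = ∧-elimʳ {adj G (U i) (support σ i)} (support-sNbr σ i)

    sNbr-of-U : ∀ {i t} → U i ~ t → t ∈S → ∃[ σ ] t ≡ support σ i
    sNbr-of-U {i} {t} Ui~t t∈S with TwoElements.only (sNbrs-of-U i) t (∧-intro Ui~t t∈S)
    ... | inj₁ t≡X = left , t≡X
    ... | inj₂ t≡Y = right , t≡Y

    support-outDeg : ∀ σ i → outDeg (support σ i) ≡ 1
    support-outDeg σ i = outside-nbr⇒outDeg-1 (support∈S σ i) (U∉S i) (~-sym (U~support σ i))

    support~U⇒ : ∀ σ i j → support σ i ~ U j → i ≡ j
    support~U⇒ σ i j e = U-injective (outside-nbr-unique (support∈S σ i) (U∉S i) (U∉S j) (~-sym (U~support σ i)) e)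

    support-injective : ∀ σ τ i j → support σ i ≡ support τ j → σ ≡ τ × i ≡ j
    support-injective σ τ i j e with support~U⇒ σ i j (subst (_~ U j) (sym e) (~-sym (U~support τ j)))
    ... | refl = side σ τ e , refl
      where
      X≢Y : ¬ support left i ≡ support right i
      X≢Y = TwoElements.fst≢snd (sNbrs-of-U i)
      side : ∀ σ τ → support σ i ≡ support τ i → σ ≡ τ
      side left  left  _ = refl
      side right right _ = refl
      side left  right e = ⊥-elim (X≢Y e)
      side right left  e = ⊥-elim (X≢Y (sym e))

    leaf : Side → Fin outside → Fin n
    leaf σ i = proj₁ (sole-sNbr (support∈S σ i))

    leaf∈S : ∀ σ i → leaf σ i ∈S
    leaf∈S σ i = proj₁ (proj₂ (sole-sNbr (support∈S σ i)))

    support~leaf : ∀ σ i → support σ i ~ leaf σ i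
    support~leaf σ i = proj₁ (proj₂ (proj₂ (sole-sNbr (support∈S σ i))))

    support-sole : ∀ σ i → SoleSNbr (support σ i) (leaf σ i)
    support-sole σ i = proj₂ (proj₂ (proj₂ (sole-sNbr (support∈S σ i))))

    leaf-outDeg : ∀ σ i → outDeg (leaf σ i) ≡ 0
    leaf-outDeg σ i = mate-of-outDeg-1 (support∈S σ i) (leaf∈S σ i) (support~leaf σ i) (support-outDeg σ i)

    leaf-nbr : ∀ σ i {t} → leaf σ i ~ t → t ≡ support σ i
    leaf-nbr σ i e = S-nbr-is-sole (leaf∈S σ i) (support∈S σ i) (~-sym (support~leaf σ i)) _ e
                                       (outDeg≡0⇒nbr∈S (leaf-outDeg σ i) e)

    leaf-injective : ∀ σ τ i j → leaf σ i ≡ leaf τ j → σ ≡ τ × i ≡ j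
    leaf-injective σ τ i j e =
      support-injective σ τ i j (leaf-nbr τ j (subst (_~ support σ i) e (~-sym (support~leaf σ i))))

    ~-flip : ∀ {u v b} → adj G u v ≡ b → adj G v u ≡ b
    ~-flip {u} {v} e = trans (Graph.sym G v u) e

    adj-U-support : ∀ σ i j → adj G (U i) (support σ j) ≡ ⌊ i ≟ j ⌋
    adj-U-support σ i j = ≡⌊≟⌋ (λ { refl → U~support σ i }) (λ e → sym (support~U⇒ σ j i (~-sym e)))

    adj-support-U : ∀ σ i j → adj G (support σ i) (U j) ≡ ⌊ i ≟ j ⌋
    adj-support-U σ i j = ≡⌊≟⌋ (λ { refl → ~-sym (U~support σ i) }) (support~U⇒ σ i j)

    adj-support-leaf : ∀ σ i j → adj G (support σ i) (leaf σ j) ≡ ⌊ i ≟ j ⌋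
    adj-support-leaf σ i j =
      ≡⌊≟⌋ (λ { refl → support~leaf σ i }) (λ e → proj₂ (support-injective σ σ i j (leaf-nbr σ j (~-sym e))))

    adj-leaf-support : ∀ σ i j → adj G (leaf σ i) (support σ j) ≡ ⌊ i ≟ j ⌋
    adj-leaf-support σ i j =
      ≡⌊≟⌋ (λ { refl → ~-sym (support~leaf σ i) }) (λ e → sym (proj₂ (support-injective σ σ j i (leaf-nbr σ i e))))

    adj-leaf-support-other : ∀ {σ τ} → ¬ σ ≡ τ → ∀ i j → adj G (leaf σ i) (support τ j) ≡ false
    adj-leaf-support-other {σ} {τ} σ≢τ i j =
      ¬-not λ e → σ≢τ (sym (proj₁ (support-injective τ σ j i (leaf-nbr σ i e))))

    adj-leaf-U : ∀ σ i j → adj G (leaf σ i) (U j) ≡ false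
    adj-leaf-U σ i j = ¬-not λ e → contradiction (trans (sym (outDeg≡0⇒nbr∈S (leaf-outDeg σ i) e)) (U∉S j)) λ ()

    adj-support-support : ∀ σ τ i j → adj G (support σ i) (support τ j) ≡ false
    adj-support-support σ τ i j = ¬-not λ e → contradiction
      (trans (sym (support-outDeg τ j)) (mate-of-outDeg-1 (support∈S σ i) (support∈S τ j) e (support-outDeg σ i))) λ ()

    adj-leaf-leaf : ∀ σ τ i j → adj G (leaf σ i) (leaf τ j) ≡ false
    adj-leaf-leaf σ τ i j = ¬-not λ e → contradiction
      (trans (sym (leaf-outDeg τ j)) (trans (cong outDeg (leaf-nbr σ i e)) (support-outDeg σ i))) λ ()

    H : Graph outside
    H = record { adj    = λ i j → adj G (U i) (U j)
               ; sym    = λ i j → Graph.sym G (U i) (U j)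
               ; irrefl = λ i → Graph.irrefl G (U i) }

    ψ : CV outside → Fin n
    ψ (base i) = U i
    ψ (x i)    = support left i
    ψ (x′ i)   = leaf left i
    ψ (y i)    = support right i
    ψ (y′ i)   = leaf right i

    ψ-adj : ∀ a b → adj G (ψ a) (ψ b) ≡ coronaAdj H a b
    ψ-adj (base i) (base j) = refl
    ψ-adj (base i) (x j)    = adj-U-support left i j
    ψ-adj (base i) (x′ j)   = ~-flip (adj-leaf-U left j i)
    ψ-adj (base i) (y j)    = adj-U-support right i j
    ψ-adj (base i) (y′ j)   = ~-flip (adj-leaf-U right j i)
    ψ-adj (x i)    (base j) = adj-support-U left i j
    ψ-adj (x i)    (x j)    = adj-support-support left left i j
    ψ-adj (x i)    (x′ j)   = adj-support-leaf left i j
    ψ-adj (x i)    (y j)    = adj-support-support left right i j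
    ψ-adj (x i)    (y′ j)   = ~-flip (adj-leaf-support-other (left≢right ∘ sym) j i)
    ψ-adj (x′ i)   (base j) = adj-leaf-U left i j
    ψ-adj (x′ i)   (x j)    = adj-leaf-support left i j
    ψ-adj (x′ i)   (x′ j)   = adj-leaf-leaf left left i j
    ψ-adj (x′ i)   (y j)    = adj-leaf-support-other left≢right i j
    ψ-adj (x′ i)   (y′ j)   = adj-leaf-leaf left right i j
    ψ-adj (y i)    (base j) = adj-support-U right i j
    ψ-adj (y i)    (x j)    = adj-support-support right left i j
    ψ-adj (y i)    (x′ j)   = ~-flip (adj-leaf-support-other left≢right j i)
    ψ-adj (y i)    (y j)    = adj-support-support right right i j
    ψ-adj (y i)    (y′ j)   = adj-support-leaf right i j
    ψ-adj (y′ i)   (base j) = adj-leaf-U right i j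
    ψ-adj (y′ i)   (x j)    = adj-leaf-support-other (left≢right ∘ sym) i j
    ψ-adj (y′ i)   (x′ j)   = adj-leaf-leaf right left i j
    ψ-adj (y′ i)   (y j)    = adj-leaf-support right i j
    ψ-adj (y′ i)   (y′ j)   = adj-leaf-leaf right right i j

    ψ-xy : ∀ σ i → ψ (xy σ i) ≡ support σ i
    ψ-xy left  i = refl
    ψ-xy right i = refl

    ψ-xy′ : ∀ σ i → ψ (xy′ σ i) ≡ leaf σ i
    ψ-xy′ left  i = refl
    ψ-xy′ right i = refl

    outDeg-1⇒support : ∀ {v} → v ∈S → outDeg v ≡ 1 → ∃[ σ ] ∃[ i ] v ≡ support σ i
    outDeg-1⇒support {v} v∈S one =
      let w , e = count-pos⇒member (outNbrs v) (≤-reflexive (sym one))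
          w∉S   = not≡true⇒≡false (∧-elimʳ {adj G v w} e)
          σ , v≡support = sNbr-of-U (subst (_~ v) (sym (U-index w∉S)) (~-sym (∧-elimˡ {adj G v w} e))) v∈S
      in σ , _ , v≡support

    ψ-surjective : ∀ v → ∃[ c ] ψ c ≡ v
    ψ-surjective v with s v in v∈S
    ... | false = base _ , U-index v∈S
    ... | true with outDeg≡0⊎1 v∈S
    ...   | inj₂ one  =
      let σ , i , v≡support = outDeg-1⇒support v∈S one in xy σ i , trans (ψ-xy σ i) (sym v≡support)
    ...   | inj₁ none =
      let m , m∈S , v~m , _ = sole-sNbr v∈S
          σ , i , m≡support = outDeg-1⇒support m∈S (mate-of-outDeg-0 v∈S m∈S v~m none)
      in xy′ σ i , trans (ψ-xy′ σ i) (sym (support-sole σ i v (subst (_~ v) m≡support (~-sym v~m)) v∈S))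

    ∉S≢∈S : ∀ {u v} → u ∉S → v ∈S → ¬ u ≡ v
    ∉S≢∈S u∉S v∈S refl = contradiction (trans (sym u∉S) v∈S) λ ()

    support≢leaf : ∀ σ i τ j → ¬ support σ i ≡ leaf τ j
    support≢leaf σ i τ j e =
      contradiction (trans (sym (support-outDeg σ i)) (trans (cong outDeg e) (leaf-outDeg τ j))) λ ()

    ψ-injective : ∀ a b → ψ a ≡ ψ b → a ≡ b
    ψ-injective (base i) (base j) e = cong base (U-injective e)
    ψ-injective (base i) (x j)    e = ⊥-elim (∉S≢∈S (U∉S i) (support∈S left j) e)
    ψ-injective (base i) (x′ j)   e = ⊥-elim (∉S≢∈S (U∉S i) (leaf∈S left j) e)
    ψ-injective (base i) (y j)    e = ⊥-elim (∉S≢∈S (U∉S i) (support∈S right j) e)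
    ψ-injective (base i) (y′ j)   e = ⊥-elim (∉S≢∈S (U∉S i) (leaf∈S right j) e)
    ψ-injective (x i)    (base j) e = ⊥-elim (∉S≢∈S (U∉S j) (support∈S left i) (sym e))
    ψ-injective (x i)    (x j)    e = cong x (proj₂ (support-injective left left i j e))
    ψ-injective (x i)    (x′ j)   e = ⊥-elim (support≢leaf left i left j e)
    ψ-injective (x i)    (y j)    e = ⊥-elim (left≢right (proj₁ (support-injective left right i j e)))
    ψ-injective (x i)    (y′ j)   e = ⊥-elim (support≢leaf left i right j e)
    ψ-injective (x′ i)   (base j) e = ⊥-elim (∉S≢∈S (U∉S j) (leaf∈S left i) (sym e))
    ψ-injective (x′ i)   (x j)    e = ⊥-elim (support≢leaf left j left i (sym e))
    ψ-injective (x′ i)   (x′ j)   e = cong x′ (proj₂ (leaf-injective left left i j e))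
    ψ-injective (x′ i)   (y j)    e = ⊥-elim (support≢leaf right j left i (sym e))
    ψ-injective (x′ i)   (y′ j)   e = ⊥-elim (left≢right (proj₁ (leaf-injective left right i j e)))
    ψ-injective (y i)    (base j) e = ⊥-elim (∉S≢∈S (U∉S j) (support∈S right i) (sym e))
    ψ-injective (y i)    (x j)    e = ⊥-elim (left≢right (proj₁ (support-injective left right j i (sym e))))
    ψ-injective (y i)    (x′ j)   e = ⊥-elim (support≢leaf right i left j e)
    ψ-injective (y i)    (y j)    e = cong y (proj₂ (support-injective right right i j e))
    ψ-injective (y i)    (y′ j)   e = ⊥-elim (support≢leaf right i right j e)
    ψ-injective (y′ i)   (base j) e = ⊥-elim (∉S≢∈S (U∉S j) (leaf∈S right i) (sym e))
    ψ-injective (y′ i)   (x j)    e = ⊥-elim (support≢leaf left j right i (sym e))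
    ψ-injective (y′ i)   (x′ j)   e = ⊥-elim (left≢right (proj₁ (leaf-injective left right j i (sym e))))
    ψ-injective (y′ i)   (y j)    e = ⊥-elim (support≢leaf right j right i (sym e))
    ψ-injective (y′ i)   (y′ j)   e = cong y′ (proj₂ (leaf-injective right right i j e))

    φ : Fin n → CV outside
    φ v = proj₁ (ψ-surjective v)

    ψ∘φ : ∀ v → ψ (φ v) ≡ v
    ψ∘φ v = proj₂ (ψ-surjective v)

    φ∘ψ : ∀ c → φ (ψ c) ≡ c
    φ∘ψ c = ψ-injective _ c (ψ∘φ (ψ c))

    φ-adj : ∀ u v → adj G u v ≡ coronaAdj H (φ u) (φ v)
    φ-adj u v = trans (sym (cong₂ (adj G) (ψ∘φ u) (ψ∘φ v))) (ψ-adj (φ u) (φ v))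

    support-nbr : ∀ σ i {t} → support σ i ~ t → t ≡ U i ⊎ t ≡ leaf σ i
    support-nbr σ i {t} e with s t in t∈S
    ... | true  = inj₂ (support-sole σ i t e t∈S)
    ... | false =
      inj₁ (trans (sym (U-index t∈S)) (cong U (sym (support~U⇒ σ i _ (subst (support σ i ~_) (sym (U-index t∈S)) e)))))

    -- With a single gadget, the three vertices that are not leaves form a total [1,2]-set smaller than S.
    module SingleGadget (one : outside ≡ 1) where

      all-equal : ∀ (i j : Fin outside) → i ≡ j
      all-equal = subst (λ k → (i j : Fin k) → i ≡ j) (sym one) λ { zero zero → refl }

      U-nbr : ∀ i {t} → U i ~ t → ∃[ σ ] t ≡ support σ i
      U-nbr i {t} e with s t in t∈S
      ... | true  = sNbr-of-U e t∈S
      ... | false = contradiction Ui~Ui λ e′ → contradiction (trans (sym e′) (Graph.irrefl G (U i))) λ ()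
        where
        Ui~Ui : U i ~ U i
        Ui~Ui = subst (λ j → U i ~ U j) (all-equal _ i) (subst (U i ~_) (sym (U-index t∈S)) e)

      nonLeaf : Fin n → Bool
      nonLeaf v = not (sealed v)

      nonLeaf-U : ∀ i → nonLeaf (U i) ≡ true
      nonLeaf-U i rewrite U∉S i = refl

      nonLeaf-support : ∀ σ i → nonLeaf (support σ i) ≡ true
      nonLeaf-support σ i rewrite support∈S σ i | support-outDeg σ i = refl

      nonLeaf-leaf : ∀ σ i → nonLeaf (leaf σ i) ≡ false
      nonLeaf-leaf σ i rewrite leaf∈S σ i | leaf-outDeg σ i = refl

      nbr-pos : ∀ {v t} → v ~ t → nonLeaf t ≡ true → 1 ≤ nbrCount G nonLeaf v
      nbr-pos {v} v~t t-nonLeaf = member⇒count-pos (λ t → adj G v t ∧ nonLeaf t) (∧-intro v~t t-nonLeaf)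

      total-at-U : ∀ i → 1 ≤ nbrCount G nonLeaf (U i) × nbrCount G nonLeaf (U i) ≤ 2
      total-at-U i = nbr-pos (U~support left i) (nonLeaf-support left i) ,
        count≤length _ (support left i ∷ support right i ∷ []) λ t e → case U-nbr i (∧-elimˡ {adj G (U i) t} e) of λ where
          (left  , t≡X) → here t≡X
          (right , t≡Y) → there (here t≡Y)

      total-at-support : ∀ σ i → 1 ≤ nbrCount G nonLeaf (support σ i) × nbrCount G nonLeaf (support σ i) ≤ 2
      total-at-support σ i = nbr-pos (~-sym (U~support σ i)) (nonLeaf-U i) ,
        ≤-trans (count≤length _ (U i ∷ []) λ t e → case support-nbr σ i (∧-elimˡ {adj G (support σ i) t} e) of λ where
          (inj₁ t≡U)    → here t≡U
          (inj₂ t≡leaf) → contradiction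
            (trans (sym (∧-elimʳ {adj G (support σ i) t} e)) (trans (cong nonLeaf t≡leaf) (nonLeaf-leaf σ i))) λ ())
          (s≤s z≤n)

      total-at-leaf : ∀ σ i → 1 ≤ nbrCount G nonLeaf (leaf σ i) × nbrCount G nonLeaf (leaf σ i) ≤ 2
      total-at-leaf σ i = nbr-pos (~-sym (support~leaf σ i)) (nonLeaf-support σ i) ,
        ≤-trans (count≤length _ (support σ i ∷ []) λ t e → here (leaf-nbr σ i (∧-elimˡ {adj G (leaf σ i) t} e)))
                (s≤s z≤n)

      nonLeaf-total : IsTotal12 G nonLeaf
      nonLeaf-total v = subst (λ v → 1 ≤ nbrCount G nonLeaf v × nbrCount G nonLeaf v ≤ 2) (ψ∘φ v) (at (φ v))
        where
        at : ∀ c → 1 ≤ nbrCount G nonLeaf (ψ c) × nbrCount G nonLeaf (ψ c) ≤ 2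
        at (base i) = total-at-U i
        at (x i)    = total-at-support left i
        at (x′ i)   = total-at-leaf left i
        at (y i)    = total-at-support right i
        at (y′ i)   = total-at-leaf right i

      count-nonLeaf≤3 : count nonLeaf ≤ 3
      count-nonLeaf≤3 = count≤length nonLeaf (U o ∷ support left o ∷ support right o ∷ []) λ v e →
        subst (_∈ U o ∷ support left o ∷ support right o ∷ []) (ψ∘φ v)
              (member (φ v) (subst (λ v → nonLeaf v ≡ true) (sym (ψ∘φ v)) e))
        where
        o : Fin outside
        o = subst Fin (sym one) zero
        member : ∀ c → nonLeaf (ψ c) ≡ true → ψ c ∈ U o ∷ support left o ∷ support right o ∷ []
        member (base i) _ = here (cong U (all-equal i o))
        member (x i)    _ = there (here (cong (support left) (all-equal i o)))
        member (y i)    _ = there (there (here (cong (support right) (all-equal i o))))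
        member (x′ i)   e = contradiction (trans (sym e) (nonLeaf-leaf left i)) λ ()
        member (y′ i)   e = contradiction (trans (sym e) (nonLeaf-leaf right i)) λ ()

      impossible : ⊥
      impossible = <⇒≱ (s≤s (s≤s (s≤s (s≤s z≤n))))
        (subst (_≤ 3) (trans |S|≡4*outside (cong (4 *_) one)) (≤-trans (minimum nonLeaf nonLeaf-total) count-nonLeaf≤3))

    n≡5*outside : n ≡ 5 * outside
    n≡5*outside = trans (sym (count-complement s)) (trans (cong (_+ outside) |S|≡4*outside) (+-comm (4 * outside) outside))

    2≤outside : 2 ≤ outside
    2≤outside with outside in eq
    ... | zero        = ⊥-elim (<⇒≱ (s≤s z≤n) (≤-trans 3≤n (≤-reflexive (trans n≡5*outside (cong (5 *_) eq)))))
    ... | suc zero    = ⊥-elim (SingleGadget.impossible eq)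
    ... | suc (suc _) = s≤s (s≤s z≤n)

    double-corona : IsDoubleCoronaOfConnected G
    double-corona = outside , H , 2≤outside , DoubleCorona.H-connected G H iso φ-adj connected , iso , φ-adj
      where
      iso : Fin n ↔ CV outside
      iso = mk↔ₛ′ φ ψ φ∘ψ ψ∘φ

theorem2p3 : (n : ℕ) → 5 ≤ n → (G : Graph n) → Connected G → HasTotal12Set G →
    ∃[ k ] (IsGammaT12 G k × 5 * k ≤ 4 * n ×
            ((5 * k ≡ 4 * n) ⇔ IsDoubleCoronaOfConnected G))
theorem2p3 n 5≤n G connected has-set with minimum-total12-set G has-set
... | M , M-total , M-minimum = ∣ M ∣ , ((M , M-total , refl) , M-minimum) , bound , mk⇔ extremal converse
  where
  |M|≡count = ∣S∣≡count M
  minimum : ∀ p → IsTotal12 G p → count (lookup M) ≤ count p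
  minimum p p-total =
    subst₂ _≤_ |M|≡count (∣tabulate∣≡count p) (M-minimum (tabulate p) (IsTotal12⇒IsTotal12Set G p-total))
  total = IsTotal12Set⇒IsTotal12 G M-total
  open MinimumTotal12 G (≤-trans (s≤s (s≤s (s≤s z≤n))) 5≤n) connected (lookup M) total minimum
  bound : 5 * ∣ M ∣ ≤ 4 * n
  bound = subst (λ c → 5 * c ≤ 4 * n) (sym |M|≡count) 5*|S|≤4*n
  extremal : 5 * ∣ M ∣ ≡ 4 * n → IsDoubleCoronaOfConnected G
  extremal eq = Extremal.double-corona (subst (λ c → 5 * c ≡ 4 * n) |M|≡count eq)
  converse : IsDoubleCoronaOfConnected G → 5 * ∣ M ∣ ≡ 4 * n
  converse (k , H , 2≤k , H-connected , iso , iso-adj) = ≤-antisym bound (begin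
    4 * n            ≡⟨ cong (4 *_) order ⟩
    4 * (5 * k)      ≡⟨ *-assoc 4 5 k ⟨
    20 * k           ≡⟨ *-assoc 5 4 k ⟩
    5 * (4 * k)      ≤⟨ *-monoʳ-≤ 5 (4*k≤|S| (lookup M) total (no-isolated-vertex H 2≤k H-connected)) ⟩
    5 * count (lookup M) ≡⟨ cong (5 *_) |M|≡count ⟨
    5 * ∣ M ∣        ∎)
    where
    open DoubleCorona G H iso iso-adj using (order; 4*k≤|S|)
    open ≤-Reasoning
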